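{- Every twin-free graph $G$ on $n$ vertices has a weak sieve $X$ with $|X|\le(n-1)/2$.
   Context: Graphs are finite, simple, undirected. A vertex $s\notin\{u,v\}$ separates $u$ and $v$ if it is adjacent to exactly one of them; distinct $u,v$ are twins if no vertex separates them; $G$ is twin-free if it has no twins. For $X\subseteq V(G)$, vertices $u,v\notin X$ are $X$-similar if $N(u)\cap X=N(v)\cap X$. $X$ sifts out $y\notin X$ if every $y'\notin X$ that is $X$-similar to $y$ equals $y$. $\mathcal S(X)$ is $X$ together with all vertices sifted out by $X$. $X$ is a weak sieve if $\mathcal S(\mathcal S(X))=V(G)$. -}

module Defs where

open import Data.Nat using (ℕ)
open import Data.Bool using (Bool; true; false)
open import Data.Fin using (Fin)
open import Data.Fin.Subset using (Subset; _∈_)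
open import Data.Product using (_×_)
open import Data.Sum using (_⊎_)
open import Relation.Binary.PropositionalEquality using (_≡_; _≢_)
open import Relation.Nullary using (¬_)

record Graph (n : ℕ) : Set where
  field
    adj    : Fin n → Fin n → Bool
    sym    : ∀ u v → adj u v ≡ adj v u
    irrefl : ∀ v → adj v v ≡ false

open Graph public

-- vertex sets given as predicates (used for the iterated closure 𝒮)
VSet : ℕ → Set₁
VSet n = Fin n → Set

⟦_⟧ : ∀ {n} → Subset n → VSet n
⟦ X ⟧ v = v ∈ X

module _ {n : ℕ} (G : Graph n) where

  Adj : Fin n → Fin n → Set
  Adj u v = adj G u v ≡ true

  Separates : Fin n → Fin n → Fin n → Set
  Separates s u v = s ≢ u × s ≢ v × ¬ (adj G s u ≡ adj G s v)

  Twins : Fin n → Fin n → Set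
  Twins u v = u ≢ v × (∀ s → ¬ Separates s u v)

  TwinFree : Set
  TwinFree = ∀ u v → ¬ Twins u v

  Similar : VSet n → Fin n → Fin n → Set
  Similar X u v = ¬ X u × ¬ X v × (∀ x → X x → (Adj x u → Adj x v) × (Adj x v → Adj x u))

  SiftsOut : VSet n → Fin n → Set
  SiftsOut X y = ¬ X y × (∀ y' → ¬ X y' → Similar X y y' → y' ≡ y)

  𝒮 : VSet n → VSet n
  𝒮 X v = X v ⊎ SiftsOut X v

  WeakSieve : Subset n → Set
  WeakSieve X = ∀ v → 𝒮 (𝒮 ⟦ X ⟧) v

-- Grow X one vertex at a time, keeping a set R of more than |X| pairwise
-- X-dissimilar vertices outside X; then |X| + |X| + 1 ≤ |X| + |R| ≤ n + 1.
-- If X is not yet a weak sieve, some u is 𝒮(X)-similar to some w ≠ u.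
-- By twin-freeness a vertex s separates u and w; s ∉ 𝒮(X), since it would tell
-- u and w apart, so s has an X-similar partner s' ≠ s. Trading s for s' in R
-- keeps R pairwise dissimilar and disjoint from X ∪ {s}. One of u, w is
-- (X ∪ {s})-dissimilar to all of R: otherwise both are similar to one r ∈ R,
-- making u and w (X ∪ {s})-similar although s separates them. Adding it to R
-- restores |R| > |X|.
module Submission where

open import Defs hiding (sym)
open import Data.Bool using (Bool; true; false)
open import Data.Bool.Properties using () renaming (_≟_ to _≟ᵇ_)
open import Data.Empty using (⊥-elim)
open import Data.Fin using (Fin; zero; suc; _≟_)
open import Data.Fin.Properties using (any?; all?; ¬∀⟶∃¬)
open import Data.Fin.Subset
  using (Subset; ⊥; ⁅_⁆; _∪_; _-_; ∁; ∣_∣; _∈_; _∉_; _⊆_; inside; outside)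
open import Data.Fin.Subset.Properties
  using ( _∈?_; ∉⊥; ∣⊥∣≡0; ∣⁅x⁆∣≡1; x∈⁅x⁆; x∈⁅y⁆⇒x≡y; x∈p∪q⁻; p⊆p∪q; q⊆p∪q
        ; p─q⊆p; p─⊥≡p; ∪-identityʳ; x∉p⇒x∈∁p; x∈∁p⇒x∉p
        ; p⊆q⇒∣p∣≤∣q∣; ∣∁p∣≡n∸∣p∣; ∣p∣≤n )
open import Data.Nat using (ℕ; zero; suc; _+_; _*_; _∸_; _≤_; s≤s)
open import Data.Nat.Properties
  using (≤-trans; ≤-reflexive; ≤-pred; +-suc; +-identityʳ; m≤o∸n⇒m+n≤o; <⇒≱; m≤m+n)
open import Data.Product using (Σ; ∃; _×_; _,_; proj₁; proj₂)
open import Data.Sum using (_⊎_; inj₁; inj₂; [_,_]′)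
open import Data.Vec using (_∷_; here; there)
open import Function using (_∘_)
open import Relation.Nullary using (¬_; Dec; yes; no; contradiction)
open import Relation.Nullary.Decidable using (¬?; _×-dec_; _⊎-dec_; _→-dec_; decidable-stable)
open import Relation.Binary.PropositionalEquality using (_≡_; _≢_; refl; sym; trans; cong; subst; subst₂)

x∉p⇒∣p∪⁅x⁆∣≡suc∣p∣ : ∀ {n} {x : Fin n} (p : Subset n) → x ∉ p → ∣ p ∪ ⁅ x ⁆ ∣ ≡ suc ∣ p ∣
x∉p⇒∣p∪⁅x⁆∣≡suc∣p∣ {x = zero}  (inside  ∷ p) x∉p = contradiction here x∉p
x∉p⇒∣p∪⁅x⁆∣≡suc∣p∣ {x = zero}  (outside ∷ p) x∉p = cong (suc ∘ ∣_∣) (∪-identityʳ p)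
x∉p⇒∣p∪⁅x⁆∣≡suc∣p∣ {x = suc x} (inside  ∷ p) x∉p = cong suc (x∉p⇒∣p∪⁅x⁆∣≡suc∣p∣ p (x∉p ∘ there))
x∉p⇒∣p∪⁅x⁆∣≡suc∣p∣ {x = suc x} (outside ∷ p) x∉p = x∉p⇒∣p∪⁅x⁆∣≡suc∣p∣ p (x∉p ∘ there)

x∈p⇒∣p∣≡suc∣p-x∣ : ∀ {n} {x : Fin n} (p : Subset n) → x ∈ p → ∣ p ∣ ≡ suc ∣ p - x ∣
x∈p⇒∣p∣≡suc∣p-x∣ {x = zero}  (inside  ∷ p) here        = cong (suc ∘ ∣_∣) (sym (p─⊥≡p p))
x∈p⇒∣p∣≡suc∣p-x∣ {x = suc x} (inside  ∷ p) (there x∈p) = cong suc (x∈p⇒∣p∣≡suc∣p-x∣ p x∈p)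
x∈p⇒∣p∣≡suc∣p-x∣ {x = suc x} (outside ∷ p) (there x∈p) = x∈p⇒∣p∣≡suc∣p-x∣ p x∈p

x∉p-x : ∀ {n} (p : Subset n) (x : Fin n) → x ∉ p - x
x∉p-x (_ ∷ p) zero    ()
x∉p-x (_ ∷ p) (suc x) (there x∈p-x) = x∉p-x p x x∈p-x

x∈p∪⁅y⁆⁻ : ∀ {n} {x y : Fin n} (p : Subset n) → x ∈ p ∪ ⁅ y ⁆ → x ∈ p ⊎ x ≡ y
x∈p∪⁅y⁆⁻ {y = y} p x∈ with x∈p∪q⁻ p ⁅ y ⁆ x∈
... | inj₁ x∈p  = inj₁ x∈p
... | inj₂ x∈⁅y⁆ = inj₂ (x∈⁅y⁆⇒x≡y y x∈⁅y⁆)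

x∉p∧x≢y⇒x∉p∪⁅y⁆ : ∀ {n} {x y : Fin n} {p : Subset n} → x ∉ p → x ≢ y → x ∉ p ∪ ⁅ y ⁆
x∉p∧x≢y⇒x∉p∪⁅y⁆ {p = p} x∉p x≢y x∈ with x∈p∪⁅y⁆⁻ p x∈
... | inj₁ x∈p = x∉p x∈p
... | inj₂ x≡y = x≢y x≡y

p⊆∁q∧∣q∣<∣p∣⇒2*∣q∣≤n : ∀ {n} {p q : Subset (suc n)} → p ⊆ ∁ q → suc ∣ q ∣ ≤ ∣ p ∣ → 2 * ∣ q ∣ ≤ n
p⊆∁q∧∣q∣<∣p∣⇒2*∣q∣≤n {n} {p} {q} p⊆∁q ∣q∣<∣p∣ =
  subst (_≤ n) (cong (∣ q ∣ +_) (sym (+-identityʳ ∣ q ∣))) (≤-pred (m≤o∸n⇒m+n≤o _ (∣p∣≤n q) ∣q∣<∣∁q∣))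
  where
  ∣q∣<∣∁q∣ : suc ∣ q ∣ ≤ suc n ∸ ∣ q ∣
  ∣q∣<∣∁q∣ = ≤-trans ∣q∣<∣p∣ (≤-trans (p⊆q⇒∣p∣≤∣q∣ p⊆∁q) (≤-reflexive (∣∁p∣≡n∸∣p∣ q)))

module _ {n : ℕ} (G : Graph n) where

  Adj? : ∀ x u → Dec (Adj G x u)
  Adj? x u = adj G x u ≟ᵇ true

  Separates? : ∀ s u w → Dec (Separates G s u w)
  Separates? s u w = ¬? (s ≟ u) ×-dec ¬? (s ≟ w) ×-dec ¬? (adj G s u ≟ᵇ adj G s w)

  module _ {P : VSet n} (P? : ∀ v → Dec (P v)) where

    Similar? : ∀ u v → Dec (Similar G P u v)
    Similar? u v = ¬? (P? u) ×-dec ¬? (P? v) ×-dec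
      all? (λ x → P? x →-dec ((Adj? x u →-dec Adj? x v) ×-dec (Adj? x v →-dec Adj? x u)))

    SiftsOut? : ∀ v → Dec (SiftsOut G P v)
    SiftsOut? v = ¬? (P? v) ×-dec all? (λ y → ¬? (P? y) →-dec (Similar? v y →-dec (y ≟ v)))

    𝒮? : ∀ v → Dec (𝒮 G P v)
    𝒮? v = P? v ⊎-dec SiftsOut? v

    ¬SiftsOut⇒partner : ∀ {v} → ¬ P v → ¬ SiftsOut G P v → ∃ λ w → w ≢ v × Similar G P v w
    ¬SiftsOut⇒partner {v} ¬Pv ¬sifted with any? (λ w → ¬? (w ≟ v) ×-dec Similar? v w)
    ... | yes partner = partner
    ... | no  none    = ⊥-elim (¬sifted (¬Pv , λ y _ v∼y →
                          decidable-stable (y ≟ v) (λ y≢v → none (y , y≢v , v∼y))))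

  WeakSieve? : ∀ X → Dec (WeakSieve G X)
  WeakSieve? X = all? (𝒮? (𝒮? (_∈? X)))

  Similar-refl : ∀ {P : VSet n} {a} → ¬ P a → Similar G P a a
  Similar-refl ¬Pa = ¬Pa , ¬Pa , λ _ _ → (λ h → h) , (λ h → h)

  Similar-sym : ∀ {P a b} → Similar G P a b → Similar G P b a
  Similar-sym (¬Pa , ¬Pb , same) = ¬Pb , ¬Pa , λ x Px → proj₂ (same x Px) , proj₁ (same x Px)

  Similar-trans : ∀ {P a b c} → Similar G P a b → Similar G P b c → Similar G P a c
  Similar-trans (¬Pa , _ , ab) (_ , ¬Pc , bc) = ¬Pa , ¬Pc , λ x Px →
    proj₁ (bc x Px) ∘ proj₁ (ab x Px) , proj₂ (ab x Px) ∘ proj₂ (bc x Px)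

  Similar-antitone : ∀ {P Q : VSet n} {a b} → (∀ {v} → P v → Q v) → Similar G Q a b → Similar G P a b
  Similar-antitone P⊆Q (¬Qa , ¬Qb , same) = ¬Qa ∘ P⊆Q , ¬Qb ∘ P⊆Q , λ x Px → same x (P⊆Q Px)

  separator∈P⇒¬Similar : ∀ {P s u w} → P s → Separates G s u w → ¬ Similar G P u w
  separator∈P⇒¬Similar Ps (_ , _ , su≢sw) (_ , _ , same) =
    su≢sw (≡true-ext (proj₁ (same _ Ps)) (proj₂ (same _ Ps)))
    where
    ≡true-ext : ∀ {a b : Bool} → (a ≡ true → b ≡ true) → (b ≡ true → a ≡ true) → a ≡ b
    ≡true-ext {false} {false} _ _ = refl
    ≡true-ext {false} {true}  _ b⇒a = b⇒a refl
    ≡true-ext {true}  {false} a⇒b _ = sym (a⇒b refl)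
    ≡true-ext {true}  {true}  _ _ = refl

  TwinFree⇒separator : TwinFree G → ∀ {u w} → u ≢ w → ∃ λ s → Separates G s u w
  TwinFree⇒separator twinFree {u} {w} u≢w with any? (λ s → Separates? s u w)
  ... | yes separator = separator
  ... | no  none      = ⊥-elim (twinFree u w (u≢w , λ s sep → none (s , sep)))

  PartialTransversal : Subset n → Subset n → Set
  PartialTransversal X R = R ⊆ ∁ X × (∀ {a b} → a ∈ R → b ∈ R → Similar G ⟦ X ⟧ a b → a ≡ b)

  Fresh : Subset n → Subset n → Fin n → Set
  Fresh X R e = ∀ {r} → r ∈ R → ¬ Similar G ⟦ X ⟧ e r

  PartialTransversal-antitone : ∀ {X X' R} → X ⊆ X' → R ⊆ ∁ X' →
                                PartialTransversal X R → PartialTransversal X' R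
  PartialTransversal-antitone X⊆X' R⊆∁X' (_ , distinct) =
    R⊆∁X' , λ a∈R b∈R a∼b → distinct a∈R b∈R (Similar-antitone X⊆X' a∼b)

  trade-out : ∀ {X R s s'} → PartialTransversal X R → Similar G ⟦ X ⟧ s s' → s' ≢ s →
              ∃ λ R' → PartialTransversal X R' × s ∉ R' × ∣ R' ∣ ≡ ∣ R ∣
  trade-out {X} {R} {s} {s'} (R⊆∁X , distinct) s∼s' s'≢s with s ∈? R
  ... | no  s∉R = R , (R⊆∁X , distinct) , s∉R , refl
  ... | yes s∈R = R' , (R'⊆∁X , distinct') , s∉R' , size
    where
    R' : Subset n
    R' = (R - s) ∪ ⁅ s' ⁆

    s≁R-s : ∀ {b} → b ∈ R - s → ¬ Similar G ⟦ X ⟧ s b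
    s≁R-s b∈R-s s∼b with distinct s∈R (p─q⊆p R ⁅ s ⁆ b∈R-s) s∼b
    ... | refl = x∉p-x R s b∈R-s

    s'∉R-s : s' ∉ R - s
    s'∉R-s s'∈R-s = s≁R-s s'∈R-s s∼s'

    s∉R' : s ∉ R'
    s∉R' s∈R' with x∈p∪⁅y⁆⁻ (R - s) s∈R'
    ... | inj₁ s∈R-s = x∉p-x R s s∈R-s
    ... | inj₂ s≡s'  = s'≢s (sym s≡s')

    size : ∣ R' ∣ ≡ ∣ R ∣
    size = trans (x∉p⇒∣p∪⁅x⁆∣≡suc∣p∣ (R - s) s'∉R-s) (sym (x∈p⇒∣p∣≡suc∣p-x∣ R s∈R))

    R'⊆∁X : R' ⊆ ∁ X
    R'⊆∁X v∈R' with x∈p∪⁅y⁆⁻ (R - s) v∈R'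
    ... | inj₁ v∈R-s = R⊆∁X (p─q⊆p R ⁅ s ⁆ v∈R-s)
    ... | inj₂ refl  = x∉p⇒x∈∁p (proj₁ (proj₂ s∼s'))

    distinct' : ∀ {a b} → a ∈ R' → b ∈ R' → Similar G ⟦ X ⟧ a b → a ≡ b
    distinct' a∈R' b∈R' a∼b with x∈p∪⁅y⁆⁻ (R - s) a∈R' | x∈p∪⁅y⁆⁻ (R - s) b∈R'
    ... | inj₁ a∈R-s | inj₁ b∈R-s = distinct (p─q⊆p R ⁅ s ⁆ a∈R-s) (p─q⊆p R ⁅ s ⁆ b∈R-s) a∼b
    ... | inj₂ refl  | inj₂ refl  = refl
    ... | inj₂ refl  | inj₁ b∈R-s = ⊥-elim (s≁R-s b∈R-s (Similar-trans s∼s' a∼b))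
    ... | inj₁ a∈R-s | inj₂ refl  = ⊥-elim (s≁R-s a∈R-s (Similar-trans s∼s' (Similar-sym a∼b)))

  separated-pair-has-fresh-end : ∀ {X X' R s u w} → PartialTransversal X R → X ⊆ X' → s ∈ X' →
                                 Separates G s u w → Similar G ⟦ X ⟧ u w →
                                 Fresh X' R u ⊎ Fresh X' R w
  separated-pair-has-fresh-end {X} {X'} {R} {s} {u} {w} (_ , distinct) X⊆X' s∈X' sep u∼w
    with any? (λ r → (r ∈? R) ×-dec Similar? (_∈? X') u r)
  ... | no  none             = inj₁ λ r∈R u∼r → none (_ , r∈R , u∼r)
  ... | yes (r , r∈R , u∼r) = inj₂ w-fresh
    where
    r≡r' : ∀ {r'} → r' ∈ R → Similar G ⟦ X' ⟧ w r' → r ≡ r'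
    r≡r' r'∈R w∼r' = distinct r∈R r'∈R
      (Similar-trans (Similar-antitone X⊆X' (Similar-sym u∼r))
        (Similar-trans u∼w (Similar-antitone X⊆X' w∼r')))

    w-fresh : Fresh X' R w
    w-fresh r'∈R w∼r' with r≡r' r'∈R w∼r'
    ... | refl = separator∈P⇒¬Similar s∈X' sep (Similar-trans u∼r (Similar-sym w∼r'))

  add-fresh : ∀ {X R e} → PartialTransversal X R → e ∉ X → Fresh X R e →
              PartialTransversal X (R ∪ ⁅ e ⁆) × ∣ R ∪ ⁅ e ⁆ ∣ ≡ suc ∣ R ∣
  add-fresh {X} {R} {e} (R⊆∁X , distinct) e∉X fresh = (R'⊆∁X , distinct') , size
    where
    size : ∣ R ∪ ⁅ e ⁆ ∣ ≡ suc ∣ R ∣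
    size = x∉p⇒∣p∪⁅x⁆∣≡suc∣p∣ R λ e∈R → fresh e∈R (Similar-refl e∉X)

    R'⊆∁X : R ∪ ⁅ e ⁆ ⊆ ∁ X
    R'⊆∁X v∈R' with x∈p∪⁅y⁆⁻ R v∈R'
    ... | inj₁ v∈R = R⊆∁X v∈R
    ... | inj₂ refl = x∉p⇒x∈∁p e∉X

    distinct' : ∀ {a b} → a ∈ R ∪ ⁅ e ⁆ → b ∈ R ∪ ⁅ e ⁆ → Similar G ⟦ X ⟧ a b → a ≡ b
    distinct' a∈R' b∈R' a∼b with x∈p∪⁅y⁆⁻ R a∈R' | x∈p∪⁅y⁆⁻ R b∈R'
    ... | inj₁ a∈R | inj₁ b∈R = distinct a∈R b∈R a∼b
    ... | inj₂ refl | inj₂ refl = refl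
    ... | inj₂ refl | inj₁ b∈R = ⊥-elim (fresh b∈R a∼b)
    ... | inj₁ a∈R | inj₂ refl = ⊥-elim (fresh a∈R (Similar-sym a∼b))

  record Obstruction (X : Subset n) : Set where
    field
      {u w s s'} : Fin n
      u∼w        : Similar G (𝒮 G ⟦ X ⟧) u w
      separates  : Separates G s u w
      s∼s'       : Similar G ⟦ X ⟧ s s'
      s'≢s       : s' ≢ s

  ¬WeakSieve⇒Obstruction : TwinFree G → ∀ {X} → ¬ WeakSieve G X → Obstruction X
  ¬WeakSieve⇒Obstruction twinFree {X} ¬ws
    with ¬∀⟶∃¬ n _ (𝒮? (𝒮? (_∈? X))) ¬ws
  ... | u , u∉𝒮𝒮X
    with ¬SiftsOut⇒partner (𝒮? (_∈? X)) (u∉𝒮𝒮X ∘ inj₁) (u∉𝒮𝒮X ∘ inj₂)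
  ... | w , w≢u , u∼w
    with TwinFree⇒separator twinFree (w≢u ∘ sym)
  ... | s , separates
    with ¬SiftsOut⇒partner (_∈? X) (s∉𝒮X ∘ inj₁) (s∉𝒮X ∘ inj₂)
    where
    s∉𝒮X : ¬ 𝒮 G ⟦ X ⟧ s
    s∉𝒮X s∈𝒮X = separator∈P⇒¬Similar s∈𝒮X separates u∼w
  ... | s' , s'≢s , s∼s' = record { u∼w = u∼w ; separates = separates ; s∼s' = s∼s' ; s'≢s = s'≢s }

  LargeTransversal : Subset n → Set
  LargeTransversal X = ∃ λ R → PartialTransversal X R × suc ∣ X ∣ ≤ ∣ R ∣

  Extension : Subset n → Set
  Extension X = ∃ λ X' → LargeTransversal X' × ∣ X' ∣ ≡ suc ∣ X ∣

  extend : ∀ {X} → LargeTransversal X → Obstruction X → Extension X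
  extend {X} (R , T , large) obstruction = extend-with (trade-out T s∼s' s'≢s)
    where
    open Obstruction obstruction

    X' : Subset n
    X' = X ∪ ⁅ s ⁆

    ∣X'∣≡suc∣X∣ : ∣ X' ∣ ≡ suc ∣ X ∣
    ∣X'∣≡suc∣X∣ = x∉p⇒∣p∪⁅x⁆∣≡suc∣p∣ X (proj₁ s∼s')

    extend-with : (∃ λ R₁ → PartialTransversal X R₁ × s ∉ R₁ × ∣ R₁ ∣ ≡ ∣ R ∣) → Extension X
    extend-with (R₁ , T₁ , s∉R₁ , ∣R₁∣≡∣R∣) =
      [ add-endpoint (proj₁ u∼w) (proj₁ separates ∘ sym)
      , add-endpoint (proj₁ (proj₂ u∼w)) (proj₁ (proj₂ separates) ∘ sym)
      ]′ (separated-pair-has-fresh-end T₁ (p⊆p∪q ⁅ s ⁆) (q⊆p∪q X ⁅ s ⁆ (x∈⁅x⁆ s)) separates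
            (Similar-antitone inj₁ u∼w))
      where
      T₁' : PartialTransversal X' R₁
      T₁' = PartialTransversal-antitone (p⊆p∪q ⁅ s ⁆)
        (λ v∈R₁ → x∉p⇒x∈∁p (x∉p∧x≢y⇒x∉p∪⁅y⁆ (x∈∁p⇒x∉p (proj₁ T₁ v∈R₁)) λ { refl → s∉R₁ v∈R₁ }))
        T₁

      add-endpoint : ∀ {e} → ¬ 𝒮 G ⟦ X ⟧ e → e ≢ s → Fresh X' R₁ e → Extension X
      add-endpoint {e} e∉𝒮X e≢s fresh with add-fresh T₁' (x∉p∧x≢y⇒x∉p∪⁅y⁆ (e∉𝒮X ∘ inj₁) e≢s) fresh
      ... | T' , ∣R'∣≡suc∣R₁∣ = X' , (R₁ ∪ ⁅ e ⁆ , T' , larger) , ∣X'∣≡suc∣X∣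
        where
        larger : suc ∣ X' ∣ ≤ ∣ R₁ ∪ ⁅ e ⁆ ∣
        larger = subst₂ _≤_ (cong suc (sym ∣X'∣≡suc∣X∣)) (sym (trans ∣R'∣≡suc∣R₁∣ (cong suc ∣R₁∣≡∣R∣)))
                   (s≤s large)

module _ {n : ℕ} (G : Graph (suc n)) where

  LargeTransversal⇒2*∣X∣≤n : ∀ {X} → LargeTransversal G X → 2 * ∣ X ∣ ≤ n
  LargeTransversal⇒2*∣X∣≤n (_ , (R⊆∁X , _) , large) = p⊆∁q∧∣q∣<∣p∣⇒2*∣q∣≤n R⊆∁X large

  LargeTransversal-⊥ : LargeTransversal G ⊥
  LargeTransversal-⊥ = ⁅ zero ⁆ , ((λ _ → x∉p⇒x∈∁p ∉⊥) , singleton-distinct) , ≤-reflexive suc∣⊥∣≡∣⁅0⁆∣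
    where
    singleton-distinct : ∀ {a b} → a ∈ ⁅ zero ⁆ → b ∈ ⁅ zero ⁆ → Similar G ⟦ ⊥ ⟧ a b → a ≡ b
    singleton-distinct a∈ b∈ _ = trans (x∈⁅y⁆⇒x≡y zero a∈) (sym (x∈⁅y⁆⇒x≡y zero b∈))

    suc∣⊥∣≡∣⁅0⁆∣ : suc ∣ ⊥ {n = suc n} ∣ ≡ ∣ ⁅ zero {suc n} ⁆ ∣
    suc∣⊥∣≡∣⁅0⁆∣ = trans (cong suc (∣⊥∣≡0 (suc n))) (sym (∣⁅x⁆∣≡1 (zero {n})))

  SmallWeakSieve : Set
  SmallWeakSieve = Σ (Subset (suc n)) (λ X → WeakSieve G X × 2 * ∣ X ∣ ≤ n)

  -- k is fuel: every extension enlarges X, and |X| ≤ n/2 throughout.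
  extend-until-WeakSieve : TwinFree G → ∀ k X → LargeTransversal G X → suc n ≤ k + ∣ X ∣ → SmallWeakSieve
  extend-until-WeakSieve twinFree k X LT fuel with WeakSieve? G X
  extend-until-WeakSieve twinFree k       X LT fuel | yes ws  = X , ws , LargeTransversal⇒2*∣X∣≤n LT
  extend-until-WeakSieve twinFree zero    X LT fuel | no  _   =
    ⊥-elim (<⇒≱ fuel (≤-trans (m≤m+n ∣ X ∣ _) (LargeTransversal⇒2*∣X∣≤n LT)))
  extend-until-WeakSieve twinFree (suc k) X LT fuel | no  ¬ws =
    continue (extend G LT (¬WeakSieve⇒Obstruction G twinFree ¬ws))
    where
    continue : Extension G X → SmallWeakSieve
    continue (X' , LT' , ∣X'∣≡suc∣X∣) = extend-until-WeakSieve twinFree k X' LT' (≤-trans fuel (≤-reflexive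
      (trans (sym (+-suc k ∣ X ∣)) (cong (k +_) (sym ∣X'∣≡suc∣X∣)))))

lemma5p13 : (n : ℕ) (G : Graph (suc n)) → TwinFree G →
    Σ (Subset (suc n)) (λ X → WeakSieve G X × 2 * ∣ X ∣ ≤ n)
lemma5p13 n G twinFree =
  extend-until-WeakSieve G twinFree (suc n) ⊥ (LargeTransversal-⊥ G) (m≤m+n (suc n) ∣ ⊥ {n = suc n} ∣)
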